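{- For any $\mathrm{SQCLP}(\mathcal{S},\mathcal{D},\mathcal{C})$-program $\mathcal{P}$ and any observable qc-atom $\varphi$: (1) $\mathcal{P}\vdash_{\mathcal{S},\mathcal{D},\mathcal{C}}\varphi \iff \mathcal{P}\models_{\mathcal{S},\mathcal{D},\mathcal{C}}\varphi \iff \mathcal{M}_{\mathcal{P}}\Vdash_{\mathcal{S},\mathcal{D},\mathcal{C}}\varphi$; (2) (soundness) $\mathcal{P}\vdash_{\mathcal{S},\mathcal{D},\mathcal{C}}\varphi \Rightarrow \mathcal{P}\models_{\mathcal{S},\mathcal{D},\mathcal{C}}\varphi$; (3) (completeness) $\mathcal{P}\models_{\mathcal{S},\mathcal{D},\mathcal{C}}\varphi \Rightarrow \mathcal{P}\vdash_{\mathcal{S},\mathcal{D},\mathcal{C}}\varphi$.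
   Context: Let $\langle \mathcal{S},\mathcal{D},\mathcal{C}\rangle$ be an admissible triple. $\mathcal{C}$ is a constraint domain whose carrier is the set of ground terms, with primitive predicates interpreted as boolean functions; $\mathcal{C}$-constraints are built from primitive atoms and equations $t == s$ by conjunction and existential quantification; $\Pi \models_{\mathcal{C}} \pi$ means every valuation (ground substitution) solving $\Pi$ solves $\pi$. $\mathcal{D}=\langle D,\trianglelefteq,\mathbf{b},\mathbf{t},\circ\rangle$ is a qualification domain: a lattice with bottom $\mathbf{b}$, top $\mathbf{t}$, greatest lower bound $\sqcap$, and attenuation operation $\circ$ (associative, commutative, monotonic, $d\circ\mathbf{t}=d$, $d\circ\mathbf{b}=\mathbf{b}$, $d\circ e\trianglelefteq e$ with $\mathbf{b}\neq d\circ e$ when $d,e\neq\mathbf{b}$, distributive over $\sqcap$), expressible in $\mathcal{C}$. $\mathcal{S}$ is a reflexive ($\mathcal{S}(x,x)=\mathbf{t}$), symmetric, not necessarily transitive $D$-valued proximity relation on variables, basic values, data constructors and predicate symbols (identity on variables; nonbottom only between identical symbols, between basic values, or between constructors, resp. defined predicates, of equal arity), extended to terms by $\mathcal{S}(t,t)=\mathbf{t}$, $\mathcal{S}(X,t)=\mathbf{b}$ for variable $X\neq t$, $\mathbf{b}$ for constructors of different arities, and $\mathcal{S}(c(t_1,\dots,t_n),c'(t'_1,\dots,t'_n))=\mathcal{S}(c,c')\sqcap\mathcal{S}(t_1,t'_1)\sqcap\dots\sqcap\mathcal{S}(t_n,t'_n)$. $t\approx_{\lambda,\Pi}s$ (for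 $\lambda\neq\mathbf{b}$) iff there are $\hat t,\hat s$ with $\Pi\models_{\mathcal{C}} t==\hat t$, $\Pi\models_{\mathcal{C}} s==\hat s$, $\mathcal{S}(\hat t,\hat s)\trianglerighteq\lambda$. A program $\mathcal{P}$ is a set of clauses $p(t_1,\dots,t_n)\leftarrow_{\alpha} B_1\#w_1,\dots,B_m\#w_m$ ($p$ defined predicate, $\alpha\in D\setminus\{\mathbf{b}\}$, $w_j\in(D\setminus\{\mathbf{b}\})\cup\{?\}$; $e\trianglerighteq^? w$ means $e\trianglerighteq w$ if $w\neq ?$, true otherwise). A qc-atom $(A\#d\Leftarrow\Pi)$ is defined, equational or primitive according to $A$, and observable iff $d\neq\mathbf{b}$ and $\Pi$ is satisfiable. $(A\#d\Leftarrow\Pi)$ entails $(A'\#d'\Leftarrow\Pi')$ iff for some substitution $\theta$, $A'=A\theta$, $d'\trianglelefteq d$, $\Pi'\models_{\mathcal{C}}\Pi\theta$. A qc-interpretation is a set of defined observable qc-atoms closed under entailment; $\mathcal{I}\Vdash_{\mathcal{S},\mathcal{D},\mathcal{C}}\varphi$ iff $\varphi$ defined and in $\mathcal{I}$, or $\varphi=((t==s)\#d\Leftarrow\Pi)$ with $t\approx_{d,\Pi}s$, or $\varphi=(\kappa\#d\Leftarrow\Pi)$ primitive with $\Pi\models_{\mathcal{C}}\kappa$. $(p'(t'_1,\dots,t'_n)\#d\Leftarrow\Pi)$ is an immediate consequence of $\mathcal{I}$ via clause $p(t_1,\dots,t_n)\leftarrow_{\alpha}B_1\#w_1,\dots,B_m\#w_m$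 iff for some substitution $\theta$ and $d_0,\dots,d_n,e_1,\dots,e_m\in D\setminus\{\mathbf{b}\}$: $\mathcal{S}(p',p)=d_0$, $t'_i\approx_{d_i,\Pi}t_i\theta$, $\mathcal{I}\Vdash(B_j\theta\#e_j\Leftarrow\Pi)$ with $e_j\trianglerighteq^? w_j$, and $d\trianglelefteq d_0\sqcap d_1\sqcap\dots\sqcap d_n\sqcap(\alpha\circ(e_1\sqcap\dots\sqcap e_m))$ (empty glb $=\mathbf{t}$). $\mathcal{I}$ is a model of $\mathcal{P}$ iff it contains all its defined observable immediate consequences via clauses of $\mathcal{P}$; $\mathcal{P}\models_{\mathcal{S},\mathcal{D},\mathcal{C}}\varphi$ iff $\mathcal{I}\Vdash_{\mathcal{S},\mathcal{D},\mathcal{C}}\varphi$ for every model $\mathcal{I}$ of $\mathcal{P}$. $\mathcal{M}_{\mathcal{P}}$ denotes the least model of $\mathcal{P}$ under set inclusion (which exists). $\mathcal{P}\vdash_{\mathcal{S},\mathcal{D},\mathcal{C}}\varphi$ means $\varphi$ is derivable in the logic $\mathrm{SQCHL}(\mathcal{S},\mathcal{D},\mathcal{C})$ with three rules: (SQDA) from premises $((t'_i==t_i\theta)\#d_i\Leftarrow\Pi)$ for $i=1..n$ and $(B_j\theta\#e_j\Leftarrow\Pi)$ for $j=1..m$ infer $(p'(t'_1,\dots,t'_n)\#d\Leftarrow\Pi)$, provided $p(t_1,\dots,t_n)\leftarrow_{\alpha}B_1\#w_1,\dots,B_m\#w_m\in\mathcal{P}$, $\theta$ a substitution, $\mathcal{S}(p',p)=d_0\neq\mathbf{b}$,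 $e_j\trianglerighteq^? w_j$ and $d\trianglelefteq d_0\sqcap d_1\sqcap\dots\sqcap d_n\sqcap(\alpha\circ(e_1\sqcap\dots\sqcap e_m))$; (SQEA) infer $((t==s)\#d\Leftarrow\Pi)$ if $t\approx_{d,\Pi}s$; (SQPA) infer $(\kappa\#d\Leftarrow\Pi)$ if $\Pi\models_{\mathcal{C}}\kappa$. -}

module Defs where

open import Data.Nat using (ℕ; _≟_)
open import Data.Bool using (Bool; true)
open import Data.Maybe using (Maybe; just; nothing)
open import Data.List using (List; []; _∷_)
open import Data.List.Relation.Unary.All using (All)
open import Data.Vec using (Vec; []; _∷_)
open import Data.Product using (Σ; ∃; ∃-syntax; _×_; _,_; proj₁)
open import Data.Unit using (⊤)
open import Data.Empty using (⊥)
open import Relation.Nullary using (¬_; yes; no)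
open import Relation.Binary.PropositionalEquality using (_≡_; _≢_)
open import Relation.Binary.Lattice.Structures using (IsBoundedLattice)

record Signature : Set₁ where
  field
    BVal  : Set
    Con   : Set
    conAr : Con → ℕ
    DPred : Set
    dAr   : DPred → ℕ
    PPred : Set
    pAr   : PPred → ℕ

module Syntax (Sg : Signature) where
  open Signature Sg

  data Term : Set where
    var : ℕ → Term
    val : BVal → Term
    con : (c : Con) → Vec Term (conAr c) → Term

  infixl 8 _⟨_⟩ _⟨_⟩ᵛ _⟨_⟩ᵃ
  Subst : Set
  Subst = ℕ → Term

  mutual
    _⟨_⟩ : Term → Subst → Term
    var x    ⟨ θ ⟩ = θ x
    val u    ⟨ θ ⟩ = val u
    con c ts ⟨ θ ⟩ = con c (ts ⟨ θ ⟩ᵛ)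

    _⟨_⟩ᵛ : ∀ {n} → Vec Term n → Subst → Vec Term n
    []       ⟨ θ ⟩ᵛ = []
    (t ∷ ts) ⟨ θ ⟩ᵛ = (t ⟨ θ ⟩) ∷ (ts ⟨ θ ⟩ᵛ)

  _⨾_ : Subst → Subst → Subst
  (θ ⨾ η) x = θ x ⟨ η ⟩

  _[_↦_] : Subst → ℕ → Term → Subst
  (η [ X ↦ t ]) y with y ≟ X
  ... | yes _ = t
  ... | no  _ = η y

  mutual
    data Ground : Term → Set where
      val : ∀ u → Ground (val u)
      con : ∀ c {ts} → GroundV ts → Ground (con c ts)

    data GroundV : ∀ {n} → Vec Term n → Set where
      []  : GroundV []
      _∷_ : ∀ {n t} {ts : Vec Term n} → Ground t → GroundV ts → GroundV (t ∷ ts)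

  IsValuation : Subst → Set
  IsValuation η = ∀ x → Ground (η x)

  data Constraint : Set where
    cprim : (r : PPred) → Vec Term (pAr r) → Constraint
    ceq   : Term → Term → Constraint
    cand  : Constraint → Constraint → Constraint
    cex   : ℕ → Constraint → Constraint

  data Atom : Set where
    def  : (p : DPred) → Vec Term (dAr p) → Atom
    prim : (r : PPred) → Vec Term (pAr r) → Atom
    eqA  : Term → Term → Atom

  _⟨_⟩ᵃ : Atom → Subst → Atom
  def p ts  ⟨ θ ⟩ᵃ = def p (ts ⟨ θ ⟩ᵛ)
  prim r ts ⟨ θ ⟩ᵃ = prim r (ts ⟨ θ ⟩ᵛ)
  eqA t s   ⟨ θ ⟩ᵃ = eqA (t ⟨ θ ⟩) (s ⟨ θ ⟩)

-- Constraint domain C: carrier = ground terms, primitive predicates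
-- interpreted as boolean functions (applied to ground arguments).

record ConstraintDomain (Sg : Signature) : Set₁ where
  open Signature Sg
  open Syntax Sg
  field
    interp : (r : PPred) → Vec Term (pAr r) → Bool

  -- η solves π   (η is intended to be a valuation)
  Sol : Subst → Constraint → Set
  Sol η (cprim r ts) = interp r (ts ⟨ η ⟩ᵛ) ≡ true
  Sol η (ceq t s)    = t ⟨ η ⟩ ≡ s ⟨ η ⟩
  Sol η (cand π π')  = Sol η π × Sol η π'
  Sol η (cex X π)    = ∃[ t ] (Ground t × Sol (η [ X ↦ t ]) π)

  SolAll : Subst → List Constraint → Set
  SolAll η Π = All (Sol η) Π

  infix 4 _⊨ᶜ_
  _⊨ᶜ_ : List Constraint → Constraint → Set
  Π ⊨ᶜ π = ∀ η → IsValuation η → SolAll η Π → Sol η π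

  -- Π' ⊨_C Πθ  (application of θ to constraints, read semantically:
  -- η solves Πθ iff θ⨾η solves Π; this avoids capture issues with ∃)
  EntailsSubst : List Constraint → List Constraint → Subst → Set
  EntailsSubst Π' Π θ = ∀ η → IsValuation η → SolAll η Π' → SolAll (θ ⨾ η) Π

  Satisfiable : List Constraint → Set
  Satisfiable Π = ∃[ η ] (IsValuation η × SolAll η Π)

record QDomain : Set₁ where
  infix 4 _⊴_
  infixl 7 _⊓_ _⊔_
  infixl 8 _∘_
  field
    D    : Set
    _⊴_  : D → D → Set
    _⊔_  : D → D → D
    _⊓_  : D → D → D
    𝐛    : D
    𝐭    : D
    isBoundedLattice : IsBoundedLattice _≡_ _⊴_ _⊔_ _⊓_ 𝐭 𝐛
    _∘_  : D → D → D
    ∘-assoc    : ∀ d e f → (d ∘ e) ∘ f ≡ d ∘ (e ∘ f)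
    ∘-comm     : ∀ d e → d ∘ e ≡ e ∘ d
    ∘-mono     : ∀ {d d' e e'} → d ⊴ d' → e ⊴ e' → (d ∘ e) ⊴ (d' ∘ e')
    ∘-identity : ∀ d → d ∘ 𝐭 ≡ d
    ∘-zero     : ∀ d → d ∘ 𝐛 ≡ 𝐛
    ∘-decr     : ∀ d e → (d ∘ e) ⊴ e
    ∘-nonzero  : ∀ {d e} → d ≢ 𝐛 → e ≢ 𝐛 → d ∘ e ≢ 𝐛
    ∘-distrib  : ∀ d e e' → d ∘ (e ⊓ e') ≡ (d ∘ e) ⊓ (d ∘ e')

record Triple : Set₁ where
  field
    sig : Signature
    cd  : ConstraintDomain sig
    qd  : QDomain
  open Signature sig public
  open Syntax sig public
  open ConstraintDomain cd public
  open QDomain qd public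
  field
    -- D expressible in C
    ι          : Σ D (λ d → d ≢ 𝐛) → Term
    ι-ground   : ∀ x → Ground (ι x)
    ι-inj      : ∀ x y → ι x ≡ ι y → proj₁ x ≡ proj₁ y
    qVal       : Constraint          -- free variable 0
    qBound     : Constraint          -- free variables 0, 1, 2
    qVal-spec  : ∀ η → IsValuation η →
                 (Sol η qVal → ∃[ x ] (η 0 ≡ ι x)) × (∀ x → η 0 ≡ ι x → Sol η qVal)
    qBound-spec : ∀ η → IsValuation η → ∀ x y z →
                 η 0 ≡ ι x → η 1 ≡ ι y → η 2 ≡ ι z →
                 (Sol η qBound → proj₁ x ⊴ (proj₁ y ∘ proj₁ z)) ×
                 (proj₁ x ⊴ (proj₁ y ∘ proj₁ z) → Sol η qBound)
    -- proximity relation S (on variables it is the identity, see simT)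
    Sval  : BVal → BVal → D
    Scon  : Con → Con → D
    Spred : DPred → DPred → D
    Sval-refl  : ∀ u → Sval u u ≡ 𝐭
    Scon-refl  : ∀ c → Scon c c ≡ 𝐭
    Spred-refl : ∀ p → Spred p p ≡ 𝐭
    Sval-sym   : ∀ u v → Sval u v ≡ Sval v u
    Scon-sym   : ∀ c c' → Scon c c' ≡ Scon c' c
    Spred-sym  : ∀ p p' → Spred p p' ≡ Spred p' p
    Scon-arity  : ∀ c c' → Scon c c' ≢ 𝐛 → conAr c ≡ conAr c'
    Spred-arity : ∀ p p' → Spred p p' ≢ 𝐛 → dAr p ≡ dAr p'

module Semantics (T : Triple) where
  open Triple T public

  mutual
    simT : Term → Term → D
    simT (var x) (var y) with x ≟ y
    ... | yes _ = 𝐭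
    ... | no  _ = 𝐛
    simT (var _)    (val _)      = 𝐛
    simT (var _)    (con _ _)    = 𝐛
    simT (val _)    (var _)      = 𝐛
    simT (con _ _)  (var _)      = 𝐛
    simT (val u)    (val v)      = Sval u v
    simT (val _)    (con _ _)    = 𝐛
    simT (con _ _)  (val _)      = 𝐛
    simT (con c ts) (con c' ss)  = Scon c c' ⊓ simV ts ss

    simV : ∀ {n m} → Vec Term n → Vec Term m → D
    simV []       []       = 𝐭
    simV (t ∷ ts) (s ∷ ss) = simT t s ⊓ simV ts ss
    simV []       (_ ∷ _)  = 𝐛
    simV (_ ∷ _)  []       = 𝐛

  Approx : D → List Constraint → Term → Term → Set
  Approx λ' Π t s = λ' ≢ 𝐛 × ∃[ t̂ ] ∃[ ŝ ]
    (Π ⊨ᶜ ceq t t̂ × Π ⊨ᶜ ceq s ŝ × λ' ⊴ simT t̂ ŝ)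

  infix 5 _#_⇐_
  record QCAtom : Set where
    constructor _#_⇐_
    field
      atom : Atom
      qual : D
      cstr : List Constraint

  Defined : QCAtom → Set
  Defined (def _ _  # _ ⇐ _) = ⊤
  Defined (prim _ _ # _ ⇐ _) = ⊥
  Defined (eqA _ _  # _ ⇐ _) = ⊥

  Observable : QCAtom → Set
  Observable (A # d ⇐ Π) = d ≢ 𝐛 × Satisfiable Π

  Entails : QCAtom → QCAtom → Set
  Entails (A # d ⇐ Π) (A' # d' ⇐ Π') =
    ∃[ θ ] (A' ≡ A ⟨ θ ⟩ᵃ × d' ⊴ d × EntailsSubst Π' Π θ)

  Interp : Set₁
  Interp = QCAtom → Set

  IsInterp : Interp → Set
  IsInterp I = (∀ φ → I φ → Defined φ × Observable φ)
             × (∀ φ ψ → I φ → Entails φ ψ → Observable ψ → I ψ)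

  infix 4 _⊩_
  _⊩_ : Interp → QCAtom → Set
  I ⊩ (def p ts  # d ⇐ Π) = I (def p ts # d ⇐ Π)
  I ⊩ (prim r ts # d ⇐ Π) = Π ⊨ᶜ cprim r ts
  I ⊩ (eqA t s   # d ⇐ Π) = Approx d Π t s

  -- weights: nothing stands for '?'
  _⊵?_ : D → Maybe D → Set
  e ⊵? nothing = ⊤
  e ⊵? just w  = w ⊴ e

  BodyElem : Set
  BodyElem = Atom × Maybe D

  WeightOK : BodyElem → Set
  WeightOK (_ , nothing) = ⊤
  WeightOK (_ , just w)  = w ≢ 𝐛

  record Clause : Set where
    field
      hd    : DPred
      args  : Vec Term (dAr hd)
      α     : D
      α≢𝐛   : α ≢ 𝐛
      body  : List BodyElem
      wOK   : All WeightOK body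

  Program : Set₁
  Program = Clause → Set

  data ArgsApprox (Π : List Constraint) : ∀ {n m} → Vec Term n → Vec Term m → D → Set where
    []  : ArgsApprox Π [] [] 𝐭
    _∷_ : ∀ {n m t' t d δ} {ts' : Vec Term n} {ts : Vec Term m} →
          Approx d Π t' t → ArgsApprox Π ts' ts δ →
          ArgsApprox Π (t' ∷ ts') (t ∷ ts) (d ⊓ δ)

  data BodyHolds (I : Interp) (Π : List Constraint) (θ : Subst) : List BodyElem → D → Set where
    []  : BodyHolds I Π θ [] 𝐭
    _∷_ : ∀ {B w e δ bs} →
          (e ≢ 𝐛 × I ⊩ (B ⟨ θ ⟩ᵃ # e ⇐ Π) × e ⊵? w) →
          BodyHolds I Π θ bs δ → BodyHolds I Π θ ((B , w) ∷ bs) (e ⊓ δ)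

  ImmCons : Interp → Clause → QCAtom → Set
  ImmCons I cl (def p' ts' # d ⇐ Π) = let open Clause cl in
    ∃[ θ ] ∃[ d₀ ] ∃[ δa ] ∃[ δb ]
      ( Spred p' hd ≡ d₀ × d₀ ≢ 𝐛
      × ArgsApprox Π ts' (args ⟨ θ ⟩ᵛ) δa
      × BodyHolds I Π θ body δb
      × d ⊴ ((d₀ ⊓ δa) ⊓ (α ∘ δb)) )
  ImmCons I cl (prim _ _ # _ ⇐ _) = ⊥
  ImmCons I cl (eqA _ _  # _ ⇐ _) = ⊥

  IsModel : Program → Interp → Set
  IsModel P I = ∀ cl → P cl → ∀ φ → Defined φ → Observable φ → ImmCons I cl φ → I φ

  _⊨_ : Program → QCAtom → Set₁
  P ⊨ φ = ∀ I → IsInterp I → IsModel P I → I ⊩ φ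

  IsLeastModel : Program → Interp → Set₁
  IsLeastModel P M = IsInterp M × IsModel P M
    × (∀ I → IsInterp I → IsModel P I → ∀ φ → M φ → I φ)

  infix 4 _⊢_ _⊨_
  data _⊢_ (P : Program) : QCAtom → Set
  data DArgs (P : Program) (Π : List Constraint) : ∀ {n m} → Vec Term n → Vec Term m → D → Set
  data DBody (P : Program) (Π : List Constraint) (θ : Subst) : List BodyElem → D → Set

  data _⊢_ P where
    SQDA : ∀ cl → P cl → ∀ (θ : Subst) p' (ts' : Vec Term (dAr p')) d Π d₀ δa δb →
           Spred p' (Clause.hd cl) ≡ d₀ → d₀ ≢ 𝐛 →
           DArgs P Π ts' (Clause.args cl ⟨ θ ⟩ᵛ) δa →
           DBody P Π θ (Clause.body cl) δb →
           d ⊴ ((d₀ ⊓ δa) ⊓ (Clause.α cl ∘ δb)) →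
           P ⊢ (def p' ts' # d ⇐ Π)
    SQEA : ∀ t s d Π → Approx d Π t s → P ⊢ (eqA t s # d ⇐ Π)
    SQPA : ∀ r ts d Π → Π ⊨ᶜ cprim r ts → P ⊢ (prim r ts # d ⇐ Π)

  data DArgs P Π where
    []  : DArgs P Π [] [] 𝐭
    _∷_ : ∀ {n m t' t d δ} {ts' : Vec Term n} {ts : Vec Term m} →
          P ⊢ (eqA t' t # d ⇐ Π) → DArgs P Π ts' ts δ →
          DArgs P Π (t' ∷ ts') (t ∷ ts) (d ⊓ δ)

  data DBody P Π θ where
    []  : DBody P Π θ [] 𝐭
    _∷_ : ∀ {B w e δ bs} →
          (P ⊢ (B ⟨ θ ⟩ᵃ # e ⇐ Π) × e ⊵? w) →
          DBody P Π θ bs δ → DBody P Π θ ((B , w) ∷ bs) (e ⊓ δ)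

-- Soundness is an induction on derivations: an (SQDA) step is exactly an
-- immediate consequence, and the premises of an observable conclusion are
-- observable because d ⊴ α ∘ (e₁ ⊓ … ⊓ eₘ) ⊴ eⱼ.  For completeness, the
-- derivable observable defined qc-atoms form a model of P: closure under
-- entailment holds because derivations survive substitution and lowering of
-- the qualification.  Everything that holds in all models therefore holds in
-- this one, i.e. is derivable.  Finally M ⊩ φ and P ⊨ φ agree because M is a
-- model contained in every model.
module Submission where

open import Defs
open import Level using (0ℓ)
open import Data.Product using (_×_; _,_)
open import Data.Vec using (Vec; []; _∷_)
open import Data.Unit using (tt)
open import Data.Empty using (⊥-elim)
open import Data.Nat using (_≟_)
open import Function.Bundles using (_⇔_; mk⇔)
open import Relation.Nullary using (yes; no)
open import Relation.Binary.PropositionalEquality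
  using (_≡_; _≢_; refl; sym; trans; cong; cong₂; subst)
open import Relation.Binary.Lattice.Structures using (IsBoundedLattice)
open import Relation.Binary.Lattice.Bundles using (MeetSemilattice)
import Relation.Binary.Lattice.Properties.MeetSemilattice as MeetSemilatticeProperties

module _ (T : Triple) where
  open Semantics T
  open IsBoundedLattice isBoundedLattice
    using (isMeetSemilattice; x∧y≤x; x∧y≤y; ∧-greatest; minimum; antisym)
    renaming (refl to ⊴-refl; trans to ⊴-trans)

  meetSemilattice : MeetSemilattice 0ℓ 0ℓ 0ℓ
  meetSemilattice = record
    { Carrier = D ; _≈_ = _≡_ ; _≤_ = _⊴_ ; _∧_ = _⊓_
    ; isMeetSemilattice = isMeetSemilattice }

  open MeetSemilatticeProperties meetSemilattice using (∧-monotonic)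

  ⊴-nonbottom : ∀ {d e} → d ≢ 𝐛 → d ⊴ e → e ≢ 𝐛
  ⊴-nonbottom {d} d≢𝐛 d⊴e refl = d≢𝐛 (antisym d⊴e (minimum d))

  mutual
    ⟨⟩-⨾ : ∀ t θ σ → t ⟨ θ ⨾ σ ⟩ ≡ t ⟨ θ ⟩ ⟨ σ ⟩
    ⟨⟩-⨾ (var x)    θ σ = refl
    ⟨⟩-⨾ (val u)    θ σ = refl
    ⟨⟩-⨾ (con c ts) θ σ = cong (con c) (⟨⟩ᵛ-⨾ ts θ σ)

    ⟨⟩ᵛ-⨾ : ∀ {n} (ts : Vec Term n) θ σ → ts ⟨ θ ⨾ σ ⟩ᵛ ≡ ts ⟨ θ ⟩ᵛ ⟨ σ ⟩ᵛ
    ⟨⟩ᵛ-⨾ []       θ σ = refl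
    ⟨⟩ᵛ-⨾ (t ∷ ts) θ σ = cong₂ _∷_ (⟨⟩-⨾ t θ σ) (⟨⟩ᵛ-⨾ ts θ σ)

  ⟨⟩ᵃ-⨾ : ∀ A θ σ → A ⟨ θ ⨾ σ ⟩ᵃ ≡ A ⟨ θ ⟩ᵃ ⟨ σ ⟩ᵃ
  ⟨⟩ᵃ-⨾ (def p ts)  θ σ = cong (def p) (⟨⟩ᵛ-⨾ ts θ σ)
  ⟨⟩ᵃ-⨾ (prim r ts) θ σ = cong (prim r) (⟨⟩ᵛ-⨾ ts θ σ)
  ⟨⟩ᵃ-⨾ (eqA t s)   θ σ = cong₂ eqA (⟨⟩-⨾ t θ σ) (⟨⟩-⨾ s θ σ)

  mutual
    ⟨⟩-ground : ∀ t η → IsValuation η → Ground (t ⟨ η ⟩)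
    ⟨⟩-ground (var x)    η η-val = η-val x
    ⟨⟩-ground (val u)    η η-val = val u
    ⟨⟩-ground (con c ts) η η-val = con c (⟨⟩ᵛ-ground ts η η-val)

    ⟨⟩ᵛ-ground : ∀ {n} (ts : Vec Term n) η → IsValuation η → GroundV (ts ⟨ η ⟩ᵛ)
    ⟨⟩ᵛ-ground []       η η-val = []
    ⟨⟩ᵛ-ground (t ∷ ts) η η-val = ⟨⟩-ground t η η-val ∷ ⟨⟩ᵛ-ground ts η η-val

  ⨾-valuation : ∀ σ η → IsValuation η → IsValuation (σ ⨾ η)
  ⨾-valuation σ η η-val x = ⟨⟩-ground (σ x) η η-val

  ≡𝐭⇒𝐭⊴ : ∀ {d} → d ≡ 𝐭 → 𝐭 ⊴ d
  ≡𝐭⇒𝐭⊴ refl = ⊴-refl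

  mutual
    simT-refl : ∀ t → 𝐭 ⊴ simT t t
    simT-refl (var x) with x ≟ x
    ... | yes _  = ⊴-refl
    ... | no x≢x = ⊥-elim (x≢x refl)
    simT-refl (val u)    = ≡𝐭⇒𝐭⊴ (Sval-refl u)
    simT-refl (con c ts) = ∧-greatest (≡𝐭⇒𝐭⊴ (Scon-refl c)) (simV-refl ts)

    simV-refl : ∀ {n} (ts : Vec Term n) → 𝐭 ⊴ simV ts ts
    simV-refl []       = ⊴-refl
    simV-refl (t ∷ ts) = ∧-greatest (simT-refl t) (simV-refl ts)

  mutual
    simT-⟨⟩ : ∀ t s σ → simT t s ⊴ simT (t ⟨ σ ⟩) (s ⟨ σ ⟩)
    simT-⟨⟩ (var x) (var y) σ with x ≟ y
    ... | yes refl = simT-refl (σ x)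
    ... | no _     = minimum _
    simT-⟨⟩ (var _)    (val _)     σ = minimum _
    simT-⟨⟩ (var _)    (con _ _)   σ = minimum _
    simT-⟨⟩ (val _)    (var _)     σ = minimum _
    simT-⟨⟩ (con _ _)  (var _)     σ = minimum _
    simT-⟨⟩ (val u)    (val v)     σ = ⊴-refl
    simT-⟨⟩ (val _)    (con _ _)   σ = minimum _
    simT-⟨⟩ (con _ _)  (val _)     σ = minimum _
    simT-⟨⟩ (con c ts) (con c' ss) σ = ∧-monotonic ⊴-refl (simV-⟨⟩ ts ss σ)

    simV-⟨⟩ : ∀ {n m} (ts : Vec Term n) (ss : Vec Term m) σ →
              simV ts ss ⊴ simV (ts ⟨ σ ⟩ᵛ) (ss ⟨ σ ⟩ᵛ)
    simV-⟨⟩ []       []       σ = ⊴-refl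
    simV-⟨⟩ (t ∷ ts) (s ∷ ss) σ = ∧-monotonic (simT-⟨⟩ t s σ) (simV-⟨⟩ ts ss σ)
    simV-⟨⟩ []       (_ ∷ _)  σ = minimum _
    simV-⟨⟩ (_ ∷ _)  []       σ = minimum _

  module _ {Π Π' σ} (Π'⊨Πσ : EntailsSubst Π' Π σ) where

    ⊨ᶜ-ceq-⟨⟩ : ∀ t s → Π ⊨ᶜ ceq t s → Π' ⊨ᶜ ceq (t ⟨ σ ⟩) (s ⟨ σ ⟩)
    ⊨ᶜ-ceq-⟨⟩ t s Π⊨t≡s η η-val η⊨Π' =
      trans (sym (⟨⟩-⨾ t σ η))
        (trans (Π⊨t≡s (σ ⨾ η) (⨾-valuation σ η η-val) (Π'⊨Πσ η η-val η⊨Π'))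
               (⟨⟩-⨾ s σ η))

    ⊨ᶜ-cprim-⟨⟩ : ∀ r ts → Π ⊨ᶜ cprim r ts → Π' ⊨ᶜ cprim r (ts ⟨ σ ⟩ᵛ)
    ⊨ᶜ-cprim-⟨⟩ r ts Π⊨rts η η-val η⊨Π' =
      subst (λ us → interp r us ≡ _) (⟨⟩ᵛ-⨾ ts σ η)
        (Π⊨rts (σ ⨾ η) (⨾-valuation σ η η-val) (Π'⊨Πσ η η-val η⊨Π'))

    Approx-⟨⟩ : ∀ {d} t s → Approx d Π t s → Approx d Π' (t ⟨ σ ⟩) (s ⟨ σ ⟩)
    Approx-⟨⟩ t s (d≢𝐛 , t̂ , ŝ , t≡t̂ , s≡ŝ , d⊴simT) =
      d≢𝐛 , t̂ ⟨ σ ⟩ , ŝ ⟨ σ ⟩ , ⊨ᶜ-ceq-⟨⟩ t t̂ t≡t̂ , ⊨ᶜ-ceq-⟨⟩ s ŝ s≡ŝ ,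
      ⊴-trans d⊴simT (simT-⟨⟩ t̂ ŝ σ)

  module _ (P : Program) where

    mutual
      ⊢-⟨⟩ : ∀ {A d Π Π' σ} → P ⊢ (A # d ⇐ Π) → EntailsSubst Π' Π σ →
             P ⊢ (A ⟨ σ ⟩ᵃ # d ⇐ Π')
      ⊢-⟨⟩ {σ = σ} (SQDA cl P∋cl θ p' ts' d Π d₀ δa δb p'≈hd d₀≢𝐛 args body d⊴) Π'⊨Πσ =
        SQDA cl P∋cl (θ ⨾ σ) p' (ts' ⟨ σ ⟩ᵛ) d _ d₀ δa δb p'≈hd d₀≢𝐛
          (subst (λ us → DArgs P _ (ts' ⟨ σ ⟩ᵛ) us δa) (sym (⟨⟩ᵛ-⨾ (Clause.args cl) θ σ))
                 (DArgs-⟨⟩ args Π'⊨Πσ))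
          (DBody-⟨⟩ body Π'⊨Πσ) d⊴
      ⊢-⟨⟩ (SQEA t s d Π t≈s)   Π'⊨Πσ = SQEA _ _ d _ (Approx-⟨⟩ Π'⊨Πσ t s t≈s)
      ⊢-⟨⟩ (SQPA r ts d Π Π⊨κ)  Π'⊨Πσ = SQPA r _ d _ (⊨ᶜ-cprim-⟨⟩ Π'⊨Πσ r ts Π⊨κ)

      DArgs-⟨⟩ : ∀ {Π Π' σ n m} {us : Vec Term n} {vs : Vec Term m} {δ} →
                 DArgs P Π us vs δ → EntailsSubst Π' Π σ →
                 DArgs P Π' (us ⟨ σ ⟩ᵛ) (vs ⟨ σ ⟩ᵛ) δ
      DArgs-⟨⟩ []         Π'⊨Πσ = []
      DArgs-⟨⟩ (u≈v ∷ us) Π'⊨Πσ = ⊢-⟨⟩ u≈v Π'⊨Πσ ∷ DArgs-⟨⟩ us Π'⊨Πσ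

      DBody-⟨⟩ : ∀ {Π Π' σ θ bs δ} → DBody P Π θ bs δ → EntailsSubst Π' Π σ →
                 DBody P Π' (θ ⨾ σ) bs δ
      DBody-⟨⟩ [] Π'⊨Πσ = []
      DBody-⟨⟩ {σ = σ} {θ} (_∷_ {B = B} (⊢Bθ , e⊵w) bs) Π'⊨Πσ =
        (subst (λ A → P ⊢ (A # _ ⇐ _)) (sym (⟨⟩ᵃ-⨾ B θ σ)) (⊢-⟨⟩ ⊢Bθ Π'⊨Πσ) , e⊵w)
        ∷ DBody-⟨⟩ bs Π'⊨Πσ

    ⊢-def-weaken : ∀ {p ts d d' Π} → P ⊢ (def p ts # d ⇐ Π) → d' ⊴ d →
                   P ⊢ (def p ts # d' ⇐ Π)
    ⊢-def-weaken (SQDA cl P∋cl θ p' ts' d Π d₀ δa δb p'≈hd d₀≢𝐛 args body d⊴) d'⊴d =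
      SQDA cl P∋cl θ p' ts' _ Π d₀ δa δb p'≈hd d₀≢𝐛 args body (⊴-trans d'⊴d d⊴)

    module _ {I : Interp} (I-model : IsModel P I) where

      DArgs⇒ArgsApprox : ∀ {Π n m} {us : Vec Term n} {vs : Vec Term m} {δ} →
                         DArgs P Π us vs δ → ArgsApprox Π us vs δ
      DArgs⇒ArgsApprox []                      = []
      DArgs⇒ArgsApprox (SQEA _ _ _ _ u≈v ∷ us) = u≈v ∷ DArgs⇒ArgsApprox us

      mutual
        ⊢-sound : ∀ {φ} → P ⊢ φ → Observable φ → I ⊩ φ
        ⊢-sound (SQDA cl P∋cl θ p' ts' d Π d₀ δa δb p'≈hd d₀≢𝐛 args body d⊴) (d≢𝐛 , Π-sat) =
          I-model cl P∋cl (def p' ts' # d ⇐ Π) tt (d≢𝐛 , Π-sat)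
            (θ , d₀ , δa , δb , p'≈hd , d₀≢𝐛 , DArgs⇒ArgsApprox args ,
             DBody-sound body d≢𝐛 d⊴δb Π-sat , d⊴)
          where
          d⊴δb : d ⊴ δb
          d⊴δb = ⊴-trans d⊴ (⊴-trans (x∧y≤y _ _) (∘-decr (Clause.α cl) δb))
        ⊢-sound (SQEA t s d Π t≈s)  _ = t≈s
        ⊢-sound (SQPA r ts d Π Π⊨κ) _ = Π⊨κ

        DBody-sound : ∀ {Π θ bs δ d} → DBody P Π θ bs δ → d ≢ 𝐛 → d ⊴ δ →
                      Satisfiable Π → BodyHolds I Π θ bs δ
        DBody-sound [] _ _ _ = []
        DBody-sound {d = d} (_∷_ {e = e} {δ = δ} (⊢Bθ , e⊵w) bs) d≢𝐛 d⊴e⊓δ Π-sat =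
          (e≢𝐛 , ⊢-sound ⊢Bθ (e≢𝐛 , Π-sat) , e⊵w)
          ∷ DBody-sound bs d≢𝐛 (⊴-trans d⊴e⊓δ (x∧y≤y e δ)) Π-sat
          where
          e≢𝐛 : e ≢ 𝐛
          e≢𝐛 = ⊴-nonbottom d≢𝐛 (⊴-trans d⊴e⊓δ (x∧y≤x e δ))

    Derivable : Interp
    Derivable φ = Defined φ × Observable φ × P ⊢ φ

    Derivable-isInterp : IsInterp Derivable
    Derivable-isInterp = (λ φ (φ-def , φ-obs , _) → φ-def , φ-obs) , entailment-closed
      where
      entailment-closed : ∀ φ ψ → Derivable φ → Entails φ ψ → Observable ψ → Derivable ψ
      entailment-closed (def _ _  # _ ⇐ _) _ (_ , _ , ⊢φ) (θ , refl , d'⊴d , Π'⊨Πθ) ψ-obs =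
        tt , ψ-obs , ⊢-def-weaken (⊢-⟨⟩ ⊢φ Π'⊨Πθ) d'⊴d
      entailment-closed (prim _ _ # _ ⇐ _) _ (() , _) _ _
      entailment-closed (eqA _ _  # _ ⇐ _) _ (() , _) _ _

    ⊩-Derivable⇒⊢ : ∀ A {e Π} → Derivable ⊩ (A # e ⇐ Π) → P ⊢ (A # e ⇐ Π)
    ⊩-Derivable⇒⊢ (def p ts)  (_ , _ , ⊢φ) = ⊢φ
    ⊩-Derivable⇒⊢ (prim r ts) Π⊨κ          = SQPA r ts _ _ Π⊨κ
    ⊩-Derivable⇒⊢ (eqA t s)   t≈s          = SQEA t s _ _ t≈s

    ArgsApprox⇒DArgs : ∀ {Π n m} {us : Vec Term n} {vs : Vec Term m} {δ} →
                       ArgsApprox Π us vs δ → DArgs P Π us vs δ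
    ArgsApprox⇒DArgs []         = []
    ArgsApprox⇒DArgs (u≈v ∷ us) = SQEA _ _ _ _ u≈v ∷ ArgsApprox⇒DArgs us

    BodyHolds⇒DBody : ∀ {Π θ bs δ} → BodyHolds Derivable Π θ bs δ → DBody P Π θ bs δ
    BodyHolds⇒DBody [] = []
    BodyHolds⇒DBody {θ = θ} (_∷_ {B = B} (_ , ⊩Bθ , e⊵w) bs) =
      (⊩-Derivable⇒⊢ (B ⟨ θ ⟩ᵃ) ⊩Bθ , e⊵w) ∷ BodyHolds⇒DBody bs

    Derivable-isModel : IsModel P Derivable
    Derivable-isModel cl P∋cl (def p' ts' # d ⇐ Π) _ φ-obs
                      (θ , d₀ , δa , δb , p'≈hd , d₀≢𝐛 , args , body , d⊴) =
      tt , φ-obs ,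
      SQDA cl P∋cl θ p' ts' d Π d₀ δa δb p'≈hd d₀≢𝐛
           (ArgsApprox⇒DArgs args) (BodyHolds⇒DBody body) d⊴

    ⊨⇒⊢ : ∀ {φ} → P ⊨ φ → P ⊢ φ
    ⊨⇒⊢ {A # _ ⇐ _} P⊨φ = ⊩-Derivable⇒⊢ A (P⊨φ Derivable Derivable-isInterp Derivable-isModel)

    ⊢⇒⊨ : ∀ {φ} → Observable φ → P ⊢ φ → P ⊨ φ
    ⊢⇒⊨ φ-obs ⊢φ I _ I-model = ⊢-sound I-model ⊢φ φ-obs

    ⊨⇔⊩-least : ∀ {M} → IsLeastModel P M → ∀ φ → P ⊨ φ ⇔ M ⊩ φ
    ⊨⇔⊩-least {M} (M-interp , M-model , M-least) φ =
      mk⇔ (λ P⊨φ → P⊨φ M M-interp M-model) (⊩-least⇒⊨ φ)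
      where
      ⊩-least⇒⊨ : ∀ φ → M ⊩ φ → P ⊨ φ
      ⊩-least⇒⊨ (def _ _  # _ ⇐ _) Mφ     I I-interp I-model = M-least I I-interp I-model _ Mφ
      ⊩-least⇒⊨ (prim _ _ # _ ⇐ _) Π⊨κ    _ _ _ = Π⊨κ
      ⊩-least⇒⊨ (eqA _ _  # _ ⇐ _) t≈s    _ _ _ = t≈s

corollary1 : (T : Triple) → let open Semantics T in
    ∀ (P : Program) (φ : QCAtom) → Observable φ →
    ∀ (M : Interp) → IsLeastModel P M →
      ((P ⊢ φ ⇔ P ⊨ φ) × (P ⊨ φ ⇔ M ⊩ φ))
      × (P ⊢ φ → P ⊨ φ)
      × (P ⊨ φ → P ⊢ φ)
corollary1 T P φ φ-obs M M-least =
  (mk⇔ sound (⊨⇒⊢ T P) , ⊨⇔⊩-least T P M-least φ) , sound , ⊨⇒⊢ T P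
  where
  open Semantics T
  sound : P ⊢ φ → P ⊨ φ
  sound = ⊢⇒⊨ T P φ-obs
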